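{- Let $\alpha=(\alpha_1,\ldots,\alpha_h)$ be a partition and let $k$ be the minimal index with $1\leq k\leq h+1$ such that $\alpha_k+\cdots+\alpha_h<\alpha_1-\alpha_2$. Assume: $\alpha\notin\mathrm{Sign}$, $(\alpha_2,\ldots,\alpha_h)\in\mathrm{Sign}$ and $\alpha_1>\alpha_2>\alpha_3+\cdots+\alpha_h$; $k\leq h$; there exists $i$ with $\alpha_i=\alpha_1-\alpha_2$; and $\alpha_i\geq\alpha_{i+1}+\cdots+\alpha_h$. Then $\beta=(|\alpha|-\alpha_1,\alpha_2+1,1^{\alpha_1-\alpha_2-1})$ is a partition with $h^\beta_{2,1}=\alpha_1$ and $\chi^\beta_\alpha=2(-1)^{\alpha_1-\alpha_2-1}$.
   Context: Empty sums are $0$. $|\lambda|$ is the sum of the parts of $\lambda$; $(b_1,\ldots,b_t,1^m)$ denotes the partition with parts $b_1,\ldots,b_t$ followed by $m$ parts equal to $1$. $h^\lambda_{i,j}$ is the hook length of node $(i,j)$ (row $i$, column $j$) of the Young diagram of $\lambda$. For partitions $\lambda,\mu$ of the same $n$, $\chi^\lambda_\mu$ is the value of the irreducible character of $S_n$ labeled by $\lambda$ on permutations of cycle type $\mu$. $\mathrm{Sign}$ denotes the set of all partitions $(\gamma_1,\ldots,\gamma_r)$ for which there exists $s$ with $0\leq s\leq r$ such that: (i) $\gamma_i>\gamma_{i+1}+\cdots+\gamma_r$ for $1\leq i\leq s$; and (ii) $(\gamma_{s+1},\ldots,\gamma_r)$ is one of $()$, $(1,1)$, $(3,2,1,1)$,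 $(5,3,2,1)$, $(a,a-1,1)$ with $a\geq 2$, $(a,a-1,2,1)$ with $a\geq 4$, or $(a,a-1,3,1)$ with $a\geq 5$. -}

module Defs where

open import Data.Nat using (ℕ; zero; suc; _+_; _∸_; _≤_; _<_; _≤ᵇ_; _≡ᵇ_)
open import Data.Bool using (Bool; true; false; if_then_else_)
open import Data.List using (List; []; _∷_; length; map; filter; drop; concatMap; upTo; replicate; foldr)
open import Data.Nat.ListAction using (sum)
open import Data.List.Relation.Unary.All using (All)
open import Data.List.Relation.Unary.Linked using (Linked)
open import Data.Product using (_×_; _,_; ∃-syntax)
open import Data.Nat using (_≥_; _>_) public
open import Data.Integer using (ℤ; +_; -_) renaming (_+_ to _+ℤ_; _*_ to _*ℤ_)
open import Data.Nat.Properties using (_≤?_)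

IsPartition : List ℕ → Set
IsPartition l = All (λ x → 0 < x) l × Linked _≥_ l

-- 1-based access λ_i, with λ_i = 0 for i = 0 or i > length λ.
at : List ℕ → ℕ → ℕ
at []       _             = 0
at (x ∷ xs) zero          = 0
at (x ∷ xs) (suc zero)    = x
at (x ∷ xs) (suc (suc i)) = at xs (suc i)

tailSum : List ℕ → ℕ → ℕ
tailSum γ k = sum (drop (k ∸ 1) γ)

size : List ℕ → ℕ
size = sum

range : ℕ → List ℕ
range n = map suc (upTo n)

conj : List ℕ → ℕ → ℕ
conj l j = length (filter (λ x → j ≤? x) l)

leg : List ℕ → ℕ → ℕ → ℕ
leg l i j = conj l j ∸ i

arm : List ℕ → ℕ → ℕ → ℕ
arm l i j = at l i ∸ j

hook : List ℕ → ℕ → ℕ → ℕ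
hook l i j = arm l i j + leg l i j + 1

cells : List ℕ → List (ℕ × ℕ)
cells l = concatMap (λ i → map (λ j → (i , j)) (range (at l i))) (range (length l))

dropZeros : List ℕ → List ℕ
dropZeros = filter (λ x → 1 ≤? x)

-- Remove the rim hook (border strip) associated with node (i,j):
-- it runs from (i, λ_i) down to (i + leg, j).
removeRim : List ℕ → ℕ → ℕ → List ℕ
removeRim l i j = dropZeros (map row (range (length l)))
  where
  e : ℕ
  e = i + leg l i j
  row : ℕ → ℕ
  row t = if t <ᵇ' i then at l t
          else if t <ᵇ' e then at l (suc t) ∸ 1
          else if t ≡ᵇ e then j ∸ 1
          else at l t
    where
    _<ᵇ'_ : ℕ → ℕ → Bool
    a <ᵇ' b = suc a ≤ᵇ b

negOnePow : ℕ → ℤ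
negOnePow zero    = + 1
negOnePow (suc n) = - negOnePow n

-- χ^λ_μ, computed by the Murnaghan–Nakayama rule: removing rim hooks of
-- length μ₁ (= nodes of hook length μ₁), with sign (−1)^{leg length}.
χ : List ℕ → List ℕ → ℤ
χ []      []      = + 1
χ (_ ∷ _) []      = + 0
χ l       (r ∷ μ) =
  foldr (λ c acc → term c +ℤ acc) (+ 0) (cells l)
  where
  term : ℕ × ℕ → ℤ
  term (i , j) = if hook l i j ≡ᵇ r
                 then negOnePow (leg l i j) *ℤ χ (removeRim l i j) μ
                 else + 0

data SignBase : List ℕ → Set where
  base-nil  : SignBase []
  base-11   : SignBase (1 ∷ 1 ∷ [])
  base-3211 : SignBase (3 ∷ 2 ∷ 1 ∷ 1 ∷ [])
  base-5321 : SignBase (5 ∷ 3 ∷ 2 ∷ 1 ∷ [])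
  base-aa1  : ∀ a → 2 ≤ a → SignBase (a ∷ (a ∸ 1) ∷ 1 ∷ [])
  base-aa21 : ∀ a → 4 ≤ a → SignBase (a ∷ (a ∸ 1) ∷ 2 ∷ 1 ∷ [])
  base-aa31 : ∀ a → 5 ≤ a → SignBase (a ∷ (a ∸ 1) ∷ 3 ∷ 1 ∷ [])

InSign : List ℕ → Set
InSign γ =
  IsPartition γ ×
  ∃[ s ] (s ≤ length γ ×
          (∀ i → 1 ≤ i → i ≤ s → at γ i > tailSum γ (suc i)) ×
          SignBase (drop s γ))

{-# OPTIONS --safe #-}
module Submission where

-- Write α = (a₁, a₂, μ) and D = a₁ − a₂. In β = (a₂ + |μ|, a₂ + 1, 1^(D−1)) exactly two cells have
-- hook length a₁: (2,1), whose rim hook leaves the one-row partition, and a cell of row 1 whose rim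
-- hook, of leg length 1, leaves (a₂, |μ| − D + 1, 1^(D−1)). In the latter only (1,2) has hook length
-- a₂, again with leg length 1, and removing it leaves (|μ| − D, 1^D). So the Murnaghan–Nakayama rule
-- gives χ^β_α = (−1)^(D−1) + χ^(|μ|−D, 1^D)_μ. For a hook (|μ| − d, 1^d) and a part d = μ_j that is
-- below all earlier parts and at least the sum of the later ones, each earlier part can only be
-- removed from the arm, and then d only from the leg, so this character is (−1)^(d−1).
-- The Sign hypotheses serve only to show that D ≤ |μ| (otherwise α ∈ Sign), so that the part equal
-- to D lies in μ, and that the parts of μ before it exceed D.

open import Defs
open import Data.Nat using (ℕ; zero; suc; _+_; _∸_; _≤_; _<_; _≥_; _>_; _≤ᵇ_; _≡ᵇ_; z≤n; s≤s; z<s)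
open import Data.Nat.Properties
open import Data.Bool using (Bool; true; false; if_then_else_)
open import Data.List using (List; []; _∷_; length; map; drop; concatMap; applyUpTo; replicate; foldr; _++_)
import Data.List.Properties as List
open import Data.List.Relation.Unary.All using (All; []; _∷_)
open import Data.List.Relation.Unary.Linked using (Linked; [-]; _∷_)
open import Data.Product using (_×_; _,_; ∃-syntax)
open import Data.Integer using (ℤ; +_; -_; _*_) renaming (_+_ to _+ℤ_)
import Data.Integer.Properties as ℤ
open import Data.Empty using (⊥-elim)
open import Relation.Nullary using (¬_; yes; no)
open import Relation.Nullary.Decidable using (dec-true; dec-false)
open import Relation.Binary.PropositionalEquality
open import Function using (_∘_)
open import Data.Nat.Solver using (module +-*-Solver)
open +-*-Solver using (solve; _:+_; con; _:=_)

if-true : ∀ {A : Set} {b : Bool} {x y : A} → b ≡ true → (if b then x else y) ≡ x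
if-true refl = refl

if-false : ∀ {A : Set} {b : Bool} {x y : A} → b ≡ false → (if b then x else y) ≡ y
if-false refl = refl

m∸1+n+1≡m+n : ∀ {m} n → 1 ≤ m → m ∸ 1 + n + 1 ≡ m + n
m∸1+n+1≡m+n {suc m} n _ = trans (+-assoc m n 1) (trans (cong (_+_ m) (+-comm n 1)) (+-suc m n))

2+[m∸1]≡1+m : ∀ {m} → 1 ≤ m → 2 + (m ∸ 1) ≡ suc m
2+[m∸1]≡1+m {suc m} _ = refl

m∸n+1+n≡1+m : ∀ {m n} → n ≤ m → m ∸ n + 1 + n ≡ suc m
m∸n+1+n≡1+m {m} {n} n≤m = trans (+-assoc (m ∸ n) 1 n) (trans (+-suc (m ∸ n) n) (cong suc (m∸n+n≡m n≤m)))

+-≥2⇒< : ∀ {a t s} → 2 ≤ t → a + t ≡ suc s → a < s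
+-≥2⇒< {a} {t} 2≤t a+t≡1+s =
  ≤-pred (subst (2 + a ≤_) a+t≡1+s (subst (_≤ a + t) (+-comm a 2) (+-monoʳ-≤ a 2≤t)))

1+m+[n∸1]≡m+n : ∀ m {n} → 1 ≤ n → suc m + (n ∸ 1) ≡ m + n
1+m+[n∸1]≡m+n m {suc n} _ = sym (+-suc m n)

i+i≡2*i : ∀ i → i +ℤ i ≡ + 2 * i
i+i≡2*i i = sym (trans (ℤ.*-distribʳ-+ i (+ 1) (+ 1)) (cong₂ _+ℤ_ (ℤ.*-identityˡ i) (ℤ.*-identityˡ i)))


sumℤ : (ℕ → ℤ) → List ℕ → ℤ
sumℤ g = foldr (λ x acc → g x +ℤ acc) (+ 0)

sumℤ-cong : ∀ {g g′ : ℕ → ℤ} → (∀ x → g x ≡ g′ x) → ∀ xs → sumℤ g xs ≡ sumℤ g′ xs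
sumℤ-cong g≗g′ []       = refl
sumℤ-cong g≗g′ (x ∷ xs) = cong₂ _+ℤ_ (g≗g′ x) (sumℤ-cong g≗g′ xs)

interval : ℕ → ℕ → List ℕ
interval a zero    = []
interval a (suc n) = a ∷ interval (suc a) n

interval-cons : ∀ a n → 1 ≤ n → interval a n ≡ a ∷ interval (suc a) (n ∸ 1)
interval-cons a (suc n) _ = refl

map-suc-applyUpTo : ∀ (f : ℕ → ℕ) a n → (∀ x → f x ≡ a + x) →
                    map suc (applyUpTo f n) ≡ interval (suc a) n
map-suc-applyUpTo f a zero    f≗a+ = refl
map-suc-applyUpTo f a (suc n) f≗a+ =
  cong₂ _∷_ (cong suc (trans (f≗a+ 0) (+-identityʳ a)))
            (map-suc-applyUpTo (f ∘ suc) (suc a) n (λ x → trans (f≗a+ (suc x)) (+-suc a x)))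

range≡interval : ∀ n → range n ≡ interval 1 n
range≡interval n = map-suc-applyUpTo (λ x → x) 0 n (λ x → refl)

interval-++ : ∀ a m n → interval a (m + n) ≡ interval a m ++ interval (a + m) n
interval-++ a zero    n = cong (λ b → interval b n) (sym (+-identityʳ a))
interval-++ a (suc m) n =
  cong (a ∷_) (trans (interval-++ (suc a) m n) (cong (λ b → interval (suc a) m ++ interval b n) (sym (+-suc a m))))

module _ {P : ℕ → Set} {a n : ℕ} where

  ∀-interval-tail : (∀ t → a ≤ t → t < a + suc n → P t) → ∀ t → suc a ≤ t → t < suc a + n → P t
  ∀-interval-tail h t a<t t<end = h t (<⇒≤ a<t) (subst (t <_) (sym (+-suc a n)) t<end)

  ∀-interval-head : (∀ t → a ≤ t → t < a + suc n → P t) → P a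
  ∀-interval-head h = h a ≤-refl (m<m+n a z<s)

sumℤ-vanishes : ∀ {g : ℕ → ℤ} a n → (∀ t → a ≤ t → t < a + n → g t ≡ + 0) →
                sumℤ g (interval a n) ≡ + 0
sumℤ-vanishes a zero    g≡0 = refl
sumℤ-vanishes a (suc n) g≡0 =
  cong₂ _+ℤ_ (∀-interval-head g≡0) (sumℤ-vanishes (suc a) n (∀-interval-tail g≡0))

sumℤ-single : ∀ {g : ℕ → ℤ} a n t₀ → a ≤ t₀ → t₀ < a + n →
              (∀ t → a ≤ t → t < a + n → t ≢ t₀ → g t ≡ + 0) →
              sumℤ g (interval a n) ≡ g t₀
sumℤ-single a zero t₀ a≤t₀ t₀<a+0 _ =
  ⊥-elim (<⇒≱ t₀<a+0 (subst (_≤ t₀) (sym (+-identityʳ a)) a≤t₀))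
sumℤ-single {g} a (suc n) t₀ a≤t₀ t₀<end g≡0 with a ≟ t₀
... | yes refl = begin
  g a +ℤ sumℤ g (interval (suc a) n) ≡⟨ cong (g a +ℤ_) (sumℤ-vanishes (suc a) n
                                          (λ t a<t t<end → ∀-interval-tail g≡0 t a<t t<end (>⇒≢ a<t))) ⟩
  g a +ℤ + 0                          ≡⟨ ℤ.+-identityʳ (g a) ⟩
  g a                                 ∎
  where open ≡-Reasoning
... | no a≢t₀ = begin
  g a +ℤ sumℤ g (interval (suc a) n) ≡⟨ cong₂ _+ℤ_ (g≡0 a ≤-refl (m<m+n a z<s) a≢t₀)
                                         (sumℤ-single (suc a) n t₀ (≤∧≢⇒< a≤t₀ a≢t₀)
                                            (subst (t₀ <_) (+-suc a n) t₀<end) (∀-interval-tail g≡0)) ⟩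
  + 0 +ℤ g t₀                         ≡⟨ ℤ.+-identityˡ (g t₀) ⟩
  g t₀                                ∎
  where open ≡-Reasoning

map-interval-const : ∀ {g : ℕ → ℕ} a n v → (∀ t → a ≤ t → t < a + n → g t ≡ v) →
                     map g (interval a n) ≡ replicate n v
map-interval-const a zero    v g≡v = refl
map-interval-const a (suc n) v g≡v =
  cong₂ _∷_ (∀-interval-head g≡v) (map-interval-const (suc a) n v (∀-interval-tail g≡v))

map-interval-two-blocks : ∀ {g : ℕ → ℕ} a n₁ n₂ v₁ v₂ →
  (∀ t → a ≤ t → t < a + n₁ → g t ≡ v₁) →
  (∀ t → a + n₁ ≤ t → t < a + (n₁ + n₂) → g t ≡ v₂) →
  map g (interval a (n₁ + n₂)) ≡ replicate n₁ v₁ ++ replicate n₂ v₂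
map-interval-two-blocks {g} a n₁ n₂ v₁ v₂ g≡v₁ g≡v₂ = begin
  map g (interval a (n₁ + n₂))                           ≡⟨ cong (map g) (interval-++ a n₁ n₂) ⟩
  map g (interval a n₁ ++ interval (a + n₁) n₂)          ≡⟨ List.map-++ g (interval a n₁) _ ⟩
  map g (interval a n₁) ++ map g (interval (a + n₁) n₂)  ≡⟨ cong₂ _++_ (map-interval-const a n₁ v₁ g≡v₁)
                                                              (map-interval-const (a + n₁) n₂ v₂ second-block) ⟩
  replicate n₁ v₁ ++ replicate n₂ v₂                     ∎
  where
  open ≡-Reasoning
  second-block : ∀ t → a + n₁ ≤ t → t < a + n₁ + n₂ → g t ≡ v₂
  second-block t start≤t t<end = g≡v₂ t start≤t (subst (t <_) (+-assoc a n₁ n₂) t<end)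


dropZeros-pos : ∀ {x} xs → 1 ≤ x → dropZeros (x ∷ xs) ≡ x ∷ dropZeros xs
dropZeros-pos xs = List.filter-accept (1 ≤?_)

dropZeros-zero : ∀ xs → dropZeros (0 ∷ xs) ≡ dropZeros xs
dropZeros-zero xs = List.filter-reject (1 ≤?_) {0} {xs} (λ ())

dropZeros-replicate-0 : ∀ n → dropZeros (replicate n 0) ≡ []
dropZeros-replicate-0 zero    = refl
dropZeros-replicate-0 (suc n) = trans (dropZeros-zero (replicate n 0)) (dropZeros-replicate-0 n)

dropZeros-replicate-1 : ∀ n → dropZeros (replicate n 1) ≡ replicate n 1
dropZeros-replicate-1 zero    = refl
dropZeros-replicate-1 (suc n) =
  trans (dropZeros-pos (replicate n 1) ≤-refl) (cong (1 ∷_) (dropZeros-replicate-1 n))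

dropZeros-ones-zeros : ∀ m n → dropZeros (replicate m 1 ++ replicate n 0) ≡ replicate m 1
dropZeros-ones-zeros m n = begin
  dropZeros (replicate m 1 ++ replicate n 0)               ≡⟨ List.filter-++ (1 ≤?_) (replicate m 1) _ ⟩
  dropZeros (replicate m 1) ++ dropZeros (replicate n 0)   ≡⟨ cong₂ _++_ (dropZeros-replicate-1 m)
                                                                          (dropZeros-replicate-0 n) ⟩
  replicate m 1 ++ []                                      ≡⟨ List.++-identityʳ _ ⟩
  replicate m 1                                            ∎
  where open ≡-Reasoning

at-replicate : ∀ q t v → 1 ≤ t → t ≤ q → at (replicate q v) t ≡ v
at-replicate (suc q) (suc zero)    v _ _         = refl
at-replicate (suc q) (suc (suc t)) v _ (s≤s t≤q) = at-replicate q (suc t) v (s≤s z≤n) t≤q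

conj-cons-≤ : ∀ {x} ν j → j ≤ x → conj (x ∷ ν) j ≡ suc (conj ν j)
conj-cons-≤ ν j j≤x = cong length (List.filter-accept (j ≤?_) j≤x)

conj-cons-> : ∀ {x} ν j → x < j → conj (x ∷ ν) j ≡ conj ν j
conj-cons-> ν j x<j = cong length (List.filter-reject (j ≤?_) (<⇒≱ x<j))

conj-ones-1 : ∀ q → conj (replicate q 1) 1 ≡ q
conj-ones-1 zero    = refl
conj-ones-1 (suc q) = trans (conj-cons-≤ (replicate q 1) 1 ≤-refl) (cong suc (conj-ones-1 q))

conj-ones-≥2 : ∀ q j → 2 ≤ j → conj (replicate q 1) j ≡ 0
conj-ones-≥2 zero    j _   = refl
conj-ones-≥2 (suc q) j 2≤j = trans (conj-cons-> (replicate q 1) j 2≤j) (conj-ones-≥2 q j 2≤j)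

Positive : List ℕ → Set
Positive = All (0 <_)

size≡0⇒[] : ∀ μ → Positive μ → size μ ≡ 0 → μ ≡ []
size≡0⇒[] []      _           _        = refl
size≡0⇒[] (x ∷ μ) (0<x ∷ _) size≡0 = ⊥-elim (<⇒≢ (≤-trans 0<x (m≤m+n x (size μ))) (sym size≡0))

nonempty⇒0<size : ∀ μ → Positive μ → 1 ≤ length μ → 0 < size μ
nonempty⇒0<size (x ∷ μ) (0<x ∷ _) _ = ≤-trans 0<x (m≤m+n x (size μ))

at<size : ∀ μ j → Positive μ → 1 ≤ j → j < length μ → at μ j < size μ
at<size (x ∷ y ∷ μ) (suc zero)    (_ ∷ 0<y ∷ _) _ _ = m<m+n x (≤-trans 0<y (m≤m+n y (size μ)))
at<size (x ∷ μ)     (suc (suc j)) (_ ∷ μ⁺)      _ (s≤s j<len) =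
  <-≤-trans (at<size μ (suc j) μ⁺ (s≤s z≤n) j<len) (m≤n+m (size μ) x)

tailSum≤size : ∀ γ k → tailSum γ k ≤ size γ
tailSum≤size γ       zero          = ≤-refl
tailSum≤size γ       (suc zero)    = ≤-refl
tailSum≤size []      (suc (suc k)) = z≤n
tailSum≤size (x ∷ γ) (suc (suc k)) = ≤-trans (tailSum≤size γ (suc k)) (m≤n+m (size γ) x)

at≤tailSum : ∀ γ k → 1 ≤ k → at γ k ≤ tailSum γ k
at≤tailSum []      k             _ = z≤n
at≤tailSum (x ∷ γ) (suc zero)    _ = m≤m+n x (size γ)
at≤tailSum (x ∷ γ) (suc (suc k)) _ = at≤tailSum γ (suc k) (s≤s z≤n)

tailSum-antitone : ∀ γ k k′ → 1 ≤ k → k ≤ k′ → tailSum γ k′ ≤ tailSum γ k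
tailSum-antitone γ       (suc zero)    k′             _ _          = tailSum≤size γ k′
tailSum-antitone γ       (suc (suc k)) (suc zero)     _ (s≤s ())
tailSum-antitone []      (suc (suc k)) (suc (suc k′)) _ _          = z≤n
tailSum-antitone (x ∷ γ) (suc (suc k)) (suc (suc k′)) _ (s≤s k<k′) =
  tailSum-antitone γ (suc k) (suc k′) (s≤s z≤n) k<k′

tailSum<at⇒< : ∀ γ {i k} → 1 ≤ i → 1 ≤ k → tailSum γ k < at γ i → i < k
tailSum<at⇒< γ {i} {k} 1≤i 1≤k tailₖ<γᵢ = ≰⇒> (λ k≤i →
  <⇒≱ tailₖ<γᵢ (≤-trans (at≤tailSum γ i 1≤i) (tailSum-antitone γ k i 1≤k k≤i)))


-- The summand of χ in Defs, so that χ (x ∷ ν) (r ∷ μ) unfolds to a fold of mnTerm over cells (x ∷ ν).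
mnTerm : List ℕ → ℕ → List ℕ → ℕ × ℕ → ℤ
mnTerm ν r μ (i , j) =
  if hook ν i j ≡ᵇ r then negOnePow (leg ν i j) * χ (removeRim ν i j) μ else + 0

mnTerm-miss : ∀ ν r μ i j → hook ν i j ≢ r → mnTerm ν r μ (i , j) ≡ + 0
mnTerm-miss ν r μ i j h≢r = if-false (dec-false (hook ν i j ≟ r) h≢r)

mnTerm-hit : ∀ ν r μ i j {g ρ} → hook ν i j ≡ r → leg ν i j ≡ g → removeRim ν i j ≡ ρ →
             mnTerm ν r μ (i , j) ≡ negOnePow g * χ ρ μ
mnTerm-hit ν r μ i j h≡r refl refl = if-true (dec-true (hook ν i j ≟ r) h≡r)

mnTerm-at : ∀ ν r μ i j {h g ρ} → hook ν i j ≡ h → leg ν i j ≡ g → removeRim ν i j ≡ ρ →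
            mnTerm ν r μ (i , j) ≡ (if h ≡ᵇ r then negOnePow g * χ ρ μ else + 0)
mnTerm-at ν r μ i j refl refl refl = refl

rowSum : (ℕ × ℕ → ℤ) → List ℕ → ℕ → ℤ
rowSum F ν i = sumℤ (λ j → F (i , j)) (interval 1 (at ν i))

foldr-cells : ∀ (F : ℕ × ℕ → ℤ) ν →
              foldr (λ c acc → F c +ℤ acc) (+ 0) (cells ν) ≡ sumℤ (rowSum F ν) (interval 1 (length ν))
foldr-cells F ν = begin
  foldr step (+ 0) (cells ν)                          ≡⟨ foldr-rows (range (length ν)) ⟩
  sumℤ (λ i → sumℤ (λ j → F (i , j)) (range (at ν i))) (range (length ν))
    ≡⟨ cong (sumℤ (λ i → sumℤ (λ j → F (i , j)) (range (at ν i)))) (range≡interval (length ν)) ⟩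
  sumℤ (λ i → sumℤ (λ j → F (i , j)) (range (at ν i))) (interval 1 (length ν))
    ≡⟨ sumℤ-cong (λ i → cong (sumℤ (λ j → F (i , j))) (range≡interval (at ν i)))
                 (interval 1 (length ν)) ⟩
  sumℤ (rowSum F ν) (interval 1 (length ν))           ∎
  where
  open ≡-Reasoning
  step : ℕ × ℕ → ℤ → ℤ
  step c acc = F c +ℤ acc
  foldr-row : ∀ i js z → foldr step z (map (i ,_) js) ≡ sumℤ (λ j → F (i , j)) js +ℤ z
  foldr-row i []       z = sym (ℤ.+-identityˡ z)
  foldr-row i (j ∷ js) z =
    trans (cong (F (i , j) +ℤ_) (foldr-row i js z)) (sym (ℤ.+-assoc (F (i , j)) _ z))
  row : ℕ → List (ℕ × ℕ)
  row i = map (i ,_) (range (at ν i))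
  foldr-rows : ∀ is → foldr step (+ 0) (concatMap row is)
                      ≡ sumℤ (λ i → sumℤ (λ j → F (i , j)) (range (at ν i))) is
  foldr-rows []       = refl
  foldr-rows (i ∷ is) = begin
    foldr step (+ 0) (row i ++ concatMap row is)
      ≡⟨ List.foldr-++ step (+ 0) (row i) (concatMap row is) ⟩
    foldr step (foldr step (+ 0) (concatMap row is)) (row i)
      ≡⟨ foldr-row i (range (at ν i)) _ ⟩
    sumℤ (λ j → F (i , j)) (range (at ν i)) +ℤ foldr step (+ 0) (concatMap row is)
      ≡⟨ cong (sumℤ (λ j → F (i , j)) (range (at ν i)) +ℤ_) (foldr-rows is) ⟩
    sumℤ (λ i → sumℤ (λ j → F (i , j)) (range (at ν i))) (i ∷ is) ∎

χ-by-rows : ∀ x ν r μ →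
            χ (x ∷ ν) (r ∷ μ) ≡ sumℤ (rowSum (mnTerm (x ∷ ν) r μ) (x ∷ ν)) (interval 1 (suc (length ν)))
χ-by-rows x ν r μ = foldr-cells (mnTerm (x ∷ ν) r μ) (x ∷ ν)

-- The row function local to removeRim.
rimRow : List ℕ → ℕ → ℕ → ℕ → ℕ
rimRow ν i j t =
  if suc t ≤ᵇ i then at ν t
  else if suc t ≤ᵇ (i + leg ν i j) then at ν (suc t) ∸ 1
  else if t ≡ᵇ (i + leg ν i j) then j ∸ 1
  else at ν t

removeRim-by-rows : ∀ ν i j → removeRim ν i j ≡ dropZeros (map (rimRow ν i j) (interval 1 (length ν)))
removeRim-by-rows ν i j = cong (dropZeros ∘ map (rimRow ν i j)) (range≡interval (length ν))

module _ (ν : List ℕ) (i j t : ℕ) where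

  rimRow-above : t < i → rimRow ν i j t ≡ at ν t
  rimRow-above t<i = if-true (dec-true (suc t ≤? i) t<i)

  rimRow-along : i ≤ t → t < i + leg ν i j → rimRow ν i j t ≡ at ν (suc t) ∸ 1
  rimRow-along i≤t t<foot =
    trans (if-false (dec-false (suc t ≤? i) (≤⇒≯ i≤t))) (if-true (dec-true (suc t ≤? _) t<foot))

  rimRow-foot : i ≤ t → t ≡ i + leg ν i j → rimRow ν i j t ≡ j ∸ 1
  rimRow-foot i≤t t≡foot =
    trans (if-false (dec-false (suc t ≤? i) (≤⇒≯ i≤t)))
      (trans (if-false (dec-false (suc t ≤? _) (λ t<foot → <-irrefl t≡foot t<foot)))
             (if-true (dec-true (t ≟ _) t≡foot)))

  rimRow-below : i + leg ν i j < t → rimRow ν i j t ≡ at ν t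
  rimRow-below foot<t =
    trans (if-false (dec-false (suc t ≤? i) (λ t<i → <-asym (≤-trans t<i (m≤m+n i _)) foot<t)))
      (trans (if-false (dec-false (suc t ≤? _) (<-asym foot<t)))
             (if-false (dec-false (t ≟ _) (>⇒≢ foot<t))))


-- The cells of hook length r are (1,1) if m + q = r, (1, m + 1 − r) if r < m, and (q + 2 − r, 1)
-- if r ≤ q: along the first row and column, hook length plus coordinate is constant.
module HookShape (m q r : ℕ) (μ : List ℕ) (1≤m : 1 ≤ m) (1≤r : 1 ≤ r) where

  private
    ν : List ℕ
    ν = m ∷ replicate q 1

    term : ℕ × ℕ → ℤ
    term = mnTerm ν r μ

    at-ν : ∀ i → 2 ≤ i → i ≤ suc q → at ν i ≡ 1
    at-ν (suc zero)    (s≤s ()) _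
    at-ν (suc (suc i)) _ (s≤s i<q) = at-replicate q (suc i) 1 (s≤s z≤n) i<q

    conj-ν-1 : conj ν 1 ≡ suc q
    conj-ν-1 = trans (conj-cons-≤ (replicate q 1) 1 1≤m) (cong suc (conj-ones-1 q))

    conj-ν-arm : ∀ j → 2 ≤ j → j ≤ m → conj ν j ≡ 1
    conj-ν-arm j 2≤j j≤m = trans (conj-cons-≤ (replicate q 1) j j≤m) (cong suc (conj-ones-≥2 q j 2≤j))

    rim-by-rows : ∀ i j → removeRim ν i j ≡ dropZeros (map (rimRow ν i j) (interval 1 (suc q)))
    rim-by-rows i j = trans (removeRim-by-rows ν i j)
      (cong (λ n → dropZeros (map (rimRow ν i j) (interval 1 (suc n)))) (List.length-replicate q))

    hook₁₁ : hook ν 1 1 ≡ m + q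
    hook₁₁ = trans (cong (λ c → m ∸ 1 + (c ∸ 1) + 1) conj-ν-1) (m∸1+n+1≡m+n q 1≤m)

    leg₁₁ : leg ν 1 1 ≡ q
    leg₁₁ = cong (_∸ 1) conj-ν-1

    rim₁₁ : removeRim ν 1 1 ≡ []
    rim₁₁ = trans (rim-by-rows 1 1)
      (trans (cong dropZeros (map-interval-const 1 (suc q) 0 emptied)) (dropZeros-replicate-0 (suc q)))
      where
      foot : 1 + leg ν 1 1 ≡ suc q
      foot = cong suc leg₁₁
      emptied : ∀ t → 1 ≤ t → t < 1 + suc q → rimRow ν 1 1 t ≡ 0
      emptied t 1≤t t<end with t <? suc q
      ... | yes t<sq = trans (rimRow-along ν 1 1 t 1≤t (subst (t <_) (sym foot) t<sq))
                             (cong (_∸ 1) (at-ν (suc t) (s≤s 1≤t) t<sq))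
      ... | no t≮sq  = rimRow-foot ν 1 1 t 1≤t (trans (≤-antisym (≤-pred t<end) (≮⇒≥ t≮sq)) (sym foot))

    hook₁ⱼ+j : ∀ j → 2 ≤ j → j ≤ m → hook ν 1 j + j ≡ suc m
    hook₁ⱼ+j j 2≤j j≤m =
      trans (cong (λ c → m ∸ j + (c ∸ 1) + 1 + j) (conj-ν-arm j 2≤j j≤m))
            (trans (cong (λ x → x + 1 + j) (+-identityʳ (m ∸ j))) (m∸n+1+n≡1+m j≤m))

    leg₁ⱼ : ∀ j → 2 ≤ j → j ≤ m → leg ν 1 j ≡ 0
    leg₁ⱼ j 2≤j j≤m = cong (_∸ 1) (conj-ν-arm j 2≤j j≤m)

    rim₁ⱼ : ∀ j → 2 ≤ j → j ≤ m → removeRim ν 1 j ≡ (j ∸ 1) ∷ replicate q 1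
    rim₁ⱼ j 2≤j j≤m = trans (rim-by-rows 1 j)
      (trans (cong dropZeros (cong₂ _∷_ (rimRow-foot ν 1 j 1 ≤-refl (sym foot)) (map-interval-const 2 q 1 kept)))
        (trans (dropZeros-pos _ (∸-monoˡ-≤ 1 2≤j)) (cong ((j ∸ 1) ∷_) (dropZeros-replicate-1 q))))
      where
      foot : 1 + leg ν 1 j ≡ 1
      foot = cong suc (leg₁ⱼ j 2≤j j≤m)
      kept : ∀ t → 2 ≤ t → t < 2 + q → rimRow ν 1 j t ≡ 1
      kept t 2≤t t<end = trans (rimRow-below ν 1 j t (subst (_< t) (sym foot) 2≤t)) (at-ν t 2≤t (≤-pred t<end))

    hookᵢ₁+i : ∀ i → 2 ≤ i → i ≤ suc q → hook ν i 1 + i ≡ suc (suc q)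
    hookᵢ₁+i i 2≤i i≤sq =
      trans (cong₂ (λ a c → a ∸ 1 + (c ∸ i) + 1 + i) (at-ν i 2≤i i≤sq) conj-ν-1) (m∸n+1+n≡1+m i≤sq)

    legᵢ₁ : ∀ i → leg ν i 1 ≡ suc q ∸ i
    legᵢ₁ i = cong (_∸ i) conj-ν-1

    rimᵢ₁ : ∀ k → k < q → removeRim ν (2 + k) 1 ≡ m ∷ replicate k 1
    rimᵢ₁ k k<q = trans (rim-by-rows (2 + k) 1)
      (trans (cong dropZeros (cong₂ _∷_ (rimRow-above ν (2 + k) 1 1 (s≤s (s≤s z≤n))) lower-rows))
        (trans (dropZeros-pos _ 1≤m) (cong (m ∷_) (dropZeros-ones-zeros k (q ∸ k)))))
      where
      q≡k+[q∸k] : k + (q ∸ k) ≡ q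
      q≡k+[q∸k] = m+[n∸m]≡n (<⇒≤ k<q)
      foot : 2 + k + leg ν (2 + k) 1 ≡ suc q
      foot = trans (cong (_+_ (2 + k)) (legᵢ₁ (2 + k))) (m+[n∸m]≡n (s≤s k<q))
      ones : ∀ t → 2 ≤ t → t < 2 + k → rimRow ν (2 + k) 1 t ≡ 1
      ones t 2≤t t<2+k = trans (rimRow-above ν (2 + k) 1 t t<2+k)
                               (at-ν t 2≤t (≤-trans (≤-pred t<2+k) (≤-trans k<q (n≤1+n q))))
      zeros : ∀ t → 2 + k ≤ t → t < 2 + (k + (q ∸ k)) → rimRow ν (2 + k) 1 t ≡ 0
      zeros t 2+k≤t t<end with t <? suc q
      ... | yes t<sq = trans (rimRow-along ν (2 + k) 1 t 2+k≤t (subst (t <_) (sym foot) t<sq))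
                             (cong (_∸ 1) (at-ν (suc t) (≤-trans (m≤m+n 2 k) (≤-trans 2+k≤t (n≤1+n t))) t<sq))
      ... | no t≮sq  = rimRow-foot ν (2 + k) 1 t 2+k≤t
                         (trans (≤-antisym (≤-pred (subst (λ n → t < 2 + n) q≡k+[q∸k] t<end)) (≮⇒≥ t≮sq))
                                (sym foot))
      lower-rows : map (rimRow ν (2 + k) 1) (interval 2 q) ≡ replicate k 1 ++ replicate (q ∸ k) 0
      lower-rows = trans (cong (map (rimRow ν (2 + k) 1) ∘ interval 2) (sym q≡k+[q∸k]))
                         (map-interval-two-blocks 2 k (q ∸ k) 1 0 ones zeros)

    corner : term (1 , 1) ≡ (if m + q ≡ᵇ r then negOnePow q * χ [] μ else + 0)
    corner = mnTerm-at ν r μ 1 1 hook₁₁ leg₁₁ rim₁₁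

    in-arm : ∀ {t} → t < 2 + (m ∸ 1) → t ≤ m
    in-arm {t} t<end = ≤-pred (subst (t <_) (2+[m∸1]≡1+m 1≤m) t<end)

    arm-cells : sumℤ (λ j → term (1 , j)) (interval 2 (m ∸ 1))
          ≡ (if suc r ≤ᵇ m then χ ((m ∸ r) ∷ replicate q 1) μ else + 0)
    arm-cells with r <? m
    ... | yes r<m = begin
      sumℤ (λ j → term (1 , j)) (interval 2 (m ∸ 1))
        ≡⟨ sumℤ-single 2 (m ∸ 1) j₀ 2≤j₀ (subst (j₀ <_) (sym (2+[m∸1]≡1+m 1≤m)) (s≤s j₀≤m))
                       others ⟩
      term (1 , j₀)
        ≡⟨ mnTerm-hit ν r μ 1 j₀ hook≡r (leg₁ⱼ j₀ 2≤j₀ j₀≤m) (rim₁ⱼ j₀ 2≤j₀ j₀≤m) ⟩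
      + 1 * χ ((m ∸ r) ∷ replicate q 1) μ
        ≡⟨ ℤ.*-identityˡ _ ⟩
      χ ((m ∸ r) ∷ replicate q 1) μ
        ≡⟨ if-true (dec-true (r <? m) r<m) ⟨
      (if suc r ≤ᵇ m then χ ((m ∸ r) ∷ replicate q 1) μ else + 0) ∎
      where
      open ≡-Reasoning
      j₀ : ℕ
      j₀ = suc (m ∸ r)
      2≤j₀ : 2 ≤ j₀
      2≤j₀ = s≤s (m<n⇒0<n∸m r<m)
      j₀≤m : j₀ ≤ m
      j₀≤m = ∸-monoʳ-< 1≤r (<⇒≤ r<m)
      r+j₀ : r + j₀ ≡ suc m
      r+j₀ = trans (+-suc r (m ∸ r)) (cong suc (m+[n∸m]≡n (<⇒≤ r<m)))
      hook≡r : hook ν 1 j₀ ≡ r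
      hook≡r = +-cancelʳ-≡ j₀ (hook ν 1 j₀) r (trans (hook₁ⱼ+j j₀ 2≤j₀ j₀≤m) (sym r+j₀))
      others : ∀ t → 2 ≤ t → t < 2 + (m ∸ 1) → t ≢ j₀ → term (1 , t) ≡ + 0
      others t 2≤t t<end t≢j₀ = mnTerm-miss ν r μ 1 t (λ hook≡r → t≢j₀ (+-cancelˡ-≡ r t j₀
        (trans (cong (_+ t) (sym hook≡r)) (trans (hook₁ⱼ+j t 2≤t (in-arm t<end)) (sym r+j₀)))))
    ... | no r≮m = trans (sumℤ-vanishes 2 (m ∸ 1) missed) (sym (if-false (dec-false (r <? m) r≮m)))
      where
      missed : ∀ t → 2 ≤ t → t < 2 + (m ∸ 1) → term (1 , t) ≡ + 0
      missed t 2≤t t<end = mnTerm-miss ν r μ 1 t (λ hook≡r →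
        r≮m (+-≥2⇒< 2≤t (trans (cong (_+ t) (sym hook≡r)) (hook₁ⱼ+j t 2≤t (in-arm t<end)))))

    row-of-leg : ∀ i → 2 ≤ i → i ≤ suc q → rowSum term ν i ≡ term (i , 1)
    row-of-leg i 2≤i i≤sq =
      trans (cong (sumℤ (λ j → term (i , j)) ∘ interval 1) (at-ν i 2≤i i≤sq)) (ℤ.+-identityʳ _)

    leg-cells : sumℤ (rowSum term ν) (interval 2 q)
           ≡ (if r ≤ᵇ q then negOnePow (r ∸ 1) * χ (m ∷ replicate (q ∸ r) 1) μ else + 0)
    leg-cells with r ≤? q
    ... | yes r≤q = begin
      sumℤ (rowSum term ν) (interval 2 q)
        ≡⟨ sumℤ-single 2 q i₀ (s≤s (s≤s z≤n)) (s≤s (s≤s q∸r<q)) others ⟩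
      rowSum term ν i₀
        ≡⟨ row-of-leg i₀ (s≤s (s≤s z≤n)) (s≤s q∸r<q) ⟩
      term (i₀ , 1)
        ≡⟨ mnTerm-hit ν r μ i₀ 1 hook≡r leg≡r∸1 (rimᵢ₁ (q ∸ r) q∸r<q) ⟩
      negOnePow (r ∸ 1) * χ (m ∷ replicate (q ∸ r) 1) μ
        ≡⟨ if-true (dec-true (r ≤? q) r≤q) ⟨
      (if r ≤ᵇ q then negOnePow (r ∸ 1) * χ (m ∷ replicate (q ∸ r) 1) μ else + 0) ∎
      where
      open ≡-Reasoning
      i₀ : ℕ
      i₀ = 2 + (q ∸ r)
      q∸r<q : q ∸ r < q
      q∸r<q = ∸-monoʳ-< 1≤r r≤q
      r+i₀ : r + i₀ ≡ suc (suc q)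
      r+i₀ = trans (+-suc r _) (cong suc (trans (+-suc r _) (cong suc (m+[n∸m]≡n r≤q))))
      hook≡r : hook ν i₀ 1 ≡ r
      hook≡r = +-cancelʳ-≡ i₀ (hook ν i₀ 1) r
                 (trans (hookᵢ₁+i i₀ (s≤s (s≤s z≤n)) (s≤s q∸r<q)) (sym r+i₀))
      leg≡r∸1 : leg ν i₀ 1 ≡ r ∸ 1
      leg≡r∸1 = trans (legᵢ₁ i₀) (trans (cong (q ∸_) (+-comm 1 (q ∸ r)))
                  (trans (sym (∸-+-assoc q (q ∸ r) 1)) (cong (_∸ 1) (m∸[m∸n]≡n r≤q))))
      others : ∀ t → 2 ≤ t → t < 2 + q → t ≢ i₀ → rowSum term ν t ≡ + 0
      others t 2≤t t<end t≢i₀ = trans (row-of-leg t 2≤t (≤-pred t<end)) (mnTerm-miss ν r μ t 1 (λ hook≡r →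
        t≢i₀ (+-cancelˡ-≡ r t i₀
          (trans (cong (_+ t) (sym hook≡r)) (trans (hookᵢ₁+i t 2≤t (≤-pred t<end)) (sym r+i₀))))))
    ... | no r≰q = trans (sumℤ-vanishes 2 q missed) (sym (if-false (dec-false (r ≤? q) r≰q)))
      where
      missed : ∀ t → 2 ≤ t → t < 2 + q → rowSum term ν t ≡ + 0
      missed t 2≤t t<end = trans (row-of-leg t 2≤t (≤-pred t<end)) (mnTerm-miss ν r μ t 1 (λ hook≡r →
        r≰q (≤-pred (+-≥2⇒< 2≤t (trans (cong (_+ t) (sym hook≡r)) (hookᵢ₁+i t 2≤t (≤-pred t<end)))))))

  χ-hookShape : χ (m ∷ replicate q 1) (r ∷ μ)
    ≡ (if m + q ≡ᵇ r then negOnePow q * χ [] μ else + 0)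
      +ℤ ((if suc r ≤ᵇ m then χ ((m ∸ r) ∷ replicate q 1) μ else + 0)
      +ℤ (if r ≤ᵇ q then negOnePow (r ∸ 1) * χ (m ∷ replicate (q ∸ r) 1) μ else + 0))
  χ-hookShape = begin
    χ ν (r ∷ μ)
      ≡⟨ χ-by-rows m (replicate q 1) r μ ⟩
    sumℤ (rowSum term ν) (interval 1 (suc (length (replicate q 1))))
      ≡⟨ cong (sumℤ (rowSum term ν) ∘ interval 1 ∘ suc) (List.length-replicate q) ⟩
    rowSum term ν 1 +ℤ sumℤ (rowSum term ν) (interval 2 q)
      ≡⟨ cong (_+ℤ sumℤ (rowSum term ν) (interval 2 q))
              (cong (sumℤ (λ j → term (1 , j))) (interval-cons 1 m 1≤m)) ⟩
    (term (1 , 1) +ℤ arm-sum) +ℤ leg-sum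
      ≡⟨ ℤ.+-assoc (term (1 , 1)) arm-sum leg-sum ⟩
    term (1 , 1) +ℤ (arm-sum +ℤ leg-sum)
      ≡⟨ cong₂ _+ℤ_ corner (cong₂ _+ℤ_ arm-cells leg-cells) ⟩
    _ ∎
    where
    open ≡-Reasoning
    arm-sum leg-sum : ℤ
    arm-sum = sumℤ (λ j → term (1 , j)) (interval 2 (m ∸ 1))
    leg-sum = sumℤ (rowSum term ν) (interval 2 q)

module _ {m q r : ℕ} (μ : List ℕ) (1≤m : 1 ≤ m) (1≤r : 1 ≤ r) where
  open HookShape m q r μ 1≤m 1≤r

  private
    r≤q⇒m+q≢r : r ≤ q → m + q ≢ r
    r≤q⇒m+q≢r r≤q m+q≡r = ≤⇒≯ (subst (_≤ q) (sym m+q≡r) r≤q) (+-monoˡ-≤ q 1≤m)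

    r<m⇒m+q≢r : r < m → m + q ≢ r
    r<m⇒m+q≢r r<m m+q≡r = <⇒≱ r<m (subst (m ≤_) m+q≡r (m≤m+n m q))

  χ-hookShape-whole : m + q ≡ r → χ (m ∷ replicate q 1) (r ∷ μ) ≡ negOnePow q * χ [] μ
  χ-hookShape-whole m+q≡r = begin
    χ (m ∷ replicate q 1) (r ∷ μ)
      ≡⟨ trans χ-hookShape (cong₂ _+ℤ_ (if-true (dec-true (m + q ≟ r) m+q≡r))
                    (cong₂ _+ℤ_ (if-false (dec-false (r <? m) (λ r<m → r<m⇒m+q≢r r<m m+q≡r)))
                                (if-false (dec-false (r ≤? q) (λ r≤q → r≤q⇒m+q≢r r≤q m+q≡r))))) ⟩
    negOnePow q * χ [] μ +ℤ (+ 0 +ℤ + 0)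
      ≡⟨ ℤ.+-identityʳ _ ⟩
    negOnePow q * χ [] μ ∎
    where open ≡-Reasoning

  χ-hookShape-arm : r < m → ¬ r ≤ q → χ (m ∷ replicate q 1) (r ∷ μ) ≡ χ ((m ∸ r) ∷ replicate q 1) μ
  χ-hookShape-arm r<m r≰q = begin
    χ (m ∷ replicate q 1) (r ∷ μ)
      ≡⟨ trans χ-hookShape (cong₂ _+ℤ_ (if-false (dec-false (m + q ≟ r) (r<m⇒m+q≢r r<m)))
                    (cong₂ _+ℤ_ (if-true (dec-true (r <? m) r<m)) (if-false (dec-false (r ≤? q) r≰q)))) ⟩
    + 0 +ℤ (χ ((m ∸ r) ∷ replicate q 1) μ +ℤ + 0)
      ≡⟨ trans (ℤ.+-identityˡ _) (ℤ.+-identityʳ _) ⟩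
    χ ((m ∸ r) ∷ replicate q 1) μ ∎
    where open ≡-Reasoning

  χ-hookShape-leg : ¬ r < m → r ≤ q →
                    χ (m ∷ replicate q 1) (r ∷ μ) ≡ negOnePow (r ∸ 1) * χ (m ∷ replicate (q ∸ r) 1) μ
  χ-hookShape-leg r≮m r≤q = begin
    χ (m ∷ replicate q 1) (r ∷ μ)
      ≡⟨ trans χ-hookShape (cong₂ _+ℤ_ (if-false (dec-false (m + q ≟ r) (r≤q⇒m+q≢r r≤q)))
                    (cong₂ _+ℤ_ (if-false (dec-false (r <? m) r≮m)) (if-true (dec-true (r ≤? q) r≤q)))) ⟩
    + 0 +ℤ (+ 0 +ℤ negOnePow (r ∸ 1) * χ (m ∷ replicate (q ∸ r) 1) μ)
      ≡⟨ trans (ℤ.+-identityˡ _) (ℤ.+-identityˡ _) ⟩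
    negOnePow (r ∸ 1) * χ (m ∷ replicate (q ∸ r) 1) μ ∎
    where open ≡-Reasoning

χ-trivial : ∀ μ n → 1 ≤ n → Positive μ → size μ ≡ n → χ (n ∷ []) μ ≡ + 1
χ-trivial []      n 1≤n _ 0≡n = ⊥-elim (<⇒≢ 1≤n 0≡n)
χ-trivial (r ∷ μ) n 1≤n (0<r ∷ μ⁺) r+μ≡n with r <? n
... | yes r<n =
  trans (χ-hookShape-arm μ 1≤n 0<r r<n (<⇒≱ 0<r)) (χ-trivial μ (n ∸ r) (m<n⇒0<n∸m r<n) μ⁺ μ≡n∸r)
  where
  μ≡n∸r : size μ ≡ n ∸ r
  μ≡n∸r = sym (trans (cong (_∸ r) (sym r+μ≡n)) (m+n∸m≡n r (size μ)))
... | no r≮n = begin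
  χ (n ∷ []) (r ∷ μ)  ≡⟨ cong (λ ρ → χ (n ∷ []) (r ∷ ρ)) μ≡[] ⟩
  χ (n ∷ []) (r ∷ []) ≡⟨ χ-hookShape-whole [] 1≤n 0<r (trans (+-identityʳ n) (sym r≡n)) ⟩
  + 1                 ∎
  where
  open ≡-Reasoning
  r≡n : r ≡ n
  r≡n = ≤-antisym (subst (r ≤_) r+μ≡n (m≤m+n r (size μ))) (≮⇒≥ r≮n)
  μ≡[] : μ ≡ []
  μ≡[] = size≡0⇒[] μ μ⁺ (+-cancelˡ-≡ r (size μ) 0 (trans r+μ≡n (trans (sym r≡n) (sym (+-identityʳ r)))))

χ-hookShape-part : ∀ μ j → Positive μ → 1 ≤ j → j < length μ →
  tailSum μ (suc j) ≤ at μ j → (∀ i → 1 ≤ i → i < j → at μ j < at μ i) →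
  χ ((size μ ∸ at μ j) ∷ replicate (at μ j) 1) μ ≡ negOnePow (at μ j ∸ 1)
χ-hookShape-part (x ∷ μ) (suc zero) (0<x ∷ μ⁺) _ (s≤s 1≤len) μ≤x _ = begin
  χ ((x + size μ ∸ x) ∷ replicate x 1) (x ∷ μ)
    ≡⟨ cong (λ m → χ (m ∷ replicate x 1) (x ∷ μ)) (m+n∸m≡n x (size μ)) ⟩
  χ (size μ ∷ replicate x 1) (x ∷ μ)
    ≡⟨ χ-hookShape-leg μ 0<size 0<x (≤⇒≯ μ≤x) ≤-refl ⟩
  negOnePow (x ∸ 1) * χ (size μ ∷ replicate (x ∸ x) 1) μ
    ≡⟨ cong (λ q → negOnePow (x ∸ 1) * χ (size μ ∷ replicate q 1) μ) (n∸n≡0 x) ⟩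
  negOnePow (x ∸ 1) * χ (size μ ∷ []) μ
    ≡⟨ cong (negOnePow (x ∸ 1) *_) (χ-trivial μ (size μ) 0<size μ⁺ refl) ⟩
  negOnePow (x ∸ 1) * + 1
    ≡⟨ ℤ.*-identityʳ _ ⟩
  negOnePow (x ∸ 1) ∎
  where
  open ≡-Reasoning
  0<size : 1 ≤ size μ
  0<size = nonempty⇒0<size μ μ⁺ 1≤len
χ-hookShape-part (x ∷ μ) (suc (suc j)) (0<x ∷ μ⁺) _ (s≤s j<len) tail≤d d<earlier = begin
  χ ((x + size μ ∸ d) ∷ replicate d 1) (x ∷ μ)
    ≡⟨ cong (λ m → χ (m ∷ replicate d 1) (x ∷ μ)) (+-∸-assoc x (<⇒≤ d<size)) ⟩
  χ ((x + (size μ ∸ d)) ∷ replicate d 1) (x ∷ μ)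
    ≡⟨ χ-hookShape-arm μ (≤-trans 0<x (m≤m+n x _)) 0<x (m<m+n x (m<n⇒0<n∸m d<size)) (<⇒≱ d<x) ⟩
  χ ((x + (size μ ∸ d) ∸ x) ∷ replicate d 1) μ
    ≡⟨ cong (λ m → χ (m ∷ replicate d 1) μ) (m+n∸m≡n x (size μ ∸ d)) ⟩
  χ ((size μ ∸ d) ∷ replicate d 1) μ
    ≡⟨ χ-hookShape-part μ (suc j) μ⁺ (s≤s z≤n) j<len tail≤d d<earlier′ ⟩
  negOnePow (d ∸ 1) ∎
  where
  open ≡-Reasoning
  d : ℕ
  d = at μ (suc j)
  d<x : d < x
  d<x = d<earlier 1 ≤-refl (s≤s (s≤s z≤n))
  d<size : d < size μ
  d<size = at<size μ (suc j) μ⁺ (s≤s z≤n) j<len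
  d<earlier′ : ∀ i → 1 ≤ i → i < suc j → d < at μ i
  d<earlier′ (suc i) _ i<j = d<earlier (suc (suc i)) (s≤s z≤n) (s≤s i<j)


conj-twoRowHook-1 : ∀ {A B} c → 1 ≤ B → B ≤ A → conj (A ∷ B ∷ replicate c 1) 1 ≡ 2 + c
conj-twoRowHook-1 c 1≤B B≤A =
  trans (conj-cons-≤ _ 1 (≤-trans 1≤B B≤A)) (cong suc (trans (conj-cons-≤ _ 1 1≤B) (cong suc (conj-ones-1 c))))

hook₂₁-twoRowHook : ∀ {A B} c → 1 ≤ B → B ≤ A → hook (A ∷ B ∷ replicate c 1) 2 1 ≡ B + c
hook₂₁-twoRowHook {B = B} c 1≤B B≤A =
  trans (cong (λ n → B ∸ 1 + (n ∸ 2) + 1) (conj-twoRowHook-1 c 1≤B B≤A)) (m∸1+n+1≡m+n c 1≤B)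

twoRowHook-isPartition : ∀ {A B} c → 1 ≤ B → B ≤ A → IsPartition (A ∷ B ∷ replicate c 1)
twoRowHook-isPartition c 1≤B B≤A =
  (≤-trans 1≤B B≤A ∷ 1≤B ∷ ones-positive c) , (B≤A ∷ ones-linked c 1≤B)
  where
  ones-positive : ∀ c → Positive (replicate c 1)
  ones-positive zero    = []
  ones-positive (suc c) = ≤-refl ∷ ones-positive c
  ones-linked : ∀ {x} c → 1 ≤ x → Linked _≥_ (x ∷ replicate c 1)
  ones-linked zero    _   = [-]
  ones-linked (suc c) 1≤x = 1≤x ∷ ones-linked c ≤-refl

-- (1, j₀) is the only cell of hook length r in row 1 (its leg length is 1), and (2, 1), of hook
-- length B + c, is the only other candidate.
module TwoRowHookShape (A B c r j₀ : ℕ) (μ : List ℕ) (2≤j₀ : 2 ≤ j₀) (j₀≤B : j₀ ≤ B) (B≤A : B ≤ A)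
                       (r+j₀≡2+A : r + j₀ ≡ 2 + A) (B≤r : B ≤ r) (c<r : c < r) where

  private
    ν : List ℕ
    ν = A ∷ B ∷ replicate c 1

    term : ℕ × ℕ → ℤ
    term = mnTerm ν r μ

    2≤B : 2 ≤ B
    2≤B = ≤-trans 2≤j₀ j₀≤B

    1≤B : 1 ≤ B
    1≤B = ≤-trans (s≤s z≤n) 2≤B

    1≤A : 1 ≤ A
    1≤A = ≤-trans 1≤B B≤A

    r≤A : r ≤ A
    r≤A = +-cancelʳ-≤ 2 r A (subst (r + 2 ≤_) (trans r+j₀≡2+A (+-comm 2 A)) (+-monoʳ-≤ r 2≤j₀))

    at-ν : ∀ i → 3 ≤ i → i ≤ 2 + c → at ν i ≡ 1
    at-ν (suc zero)          (s≤s ())             _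
    at-ν (suc (suc zero))    (s≤s (s≤s ()))       _
    at-ν (suc (suc (suc i))) _ (s≤s (s≤s i<c)) = at-replicate c (suc i) 1 (s≤s z≤n) i<c

    conj-ν-1 : conj ν 1 ≡ 2 + c
    conj-ν-1 = conj-twoRowHook-1 c 1≤B B≤A

    conj-ν-low : ∀ j → 2 ≤ j → j ≤ B → conj ν j ≡ 2
    conj-ν-low j 2≤j j≤B =
      trans (conj-cons-≤ _ j (≤-trans j≤B B≤A))
            (cong suc (trans (conj-cons-≤ _ j j≤B) (cong suc (conj-ones-≥2 c j 2≤j))))

    conj-ν-high : ∀ j → B < j → j ≤ A → conj ν j ≡ 1
    conj-ν-high j B<j j≤A =
      trans (conj-cons-≤ _ j j≤A)
            (cong suc (trans (conj-cons-> _ j B<j) (conj-ones-≥2 c j (≤-trans 2≤B (<⇒≤ B<j)))))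

    rim-by-rows : ∀ i j → removeRim ν i j ≡ dropZeros (map (rimRow ν i j) (interval 1 (2 + c)))
    rim-by-rows i j = trans (removeRim-by-rows ν i j)
      (cong (λ n → dropZeros (map (rimRow ν i j) (interval 1 (2 + n)))) (List.length-replicate c))

    hook₁₁≢r : hook ν 1 1 ≢ r
    hook₁₁≢r hook≡r = ≤⇒≯ r≤A (subst (A <_) hook≡r (begin-strict
      A                             <⟨ m<m+n A z<s ⟩
      A + suc c                     ≡⟨ m∸1+n+1≡m+n (suc c) 1≤A ⟨
      A ∸ 1 + (2 + c ∸ 1) + 1       ≡⟨ cong (λ n → A ∸ 1 + (n ∸ 1) + 1) conj-ν-1 ⟨
      hook ν 1 1                    ∎))
      where open ≤-Reasoning

    hook₁ⱼ+j-low : ∀ j → 2 ≤ j → j ≤ B → hook ν 1 j + j ≡ 2 + A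
    hook₁ⱼ+j-low j 2≤j j≤B = begin
      A ∸ j + (conj ν j ∸ 1) + 1 + j  ≡⟨ cong (λ n → A ∸ j + (n ∸ 1) + 1 + j) (conj-ν-low j 2≤j j≤B) ⟩
      A ∸ j + 1 + 1 + j               ≡⟨ trans (+-assoc (A ∸ j + 1) 1 j) (+-suc (A ∸ j + 1) j) ⟩
      suc (A ∸ j + 1 + j)             ≡⟨ cong suc (m∸n+1+n≡1+m (≤-trans j≤B B≤A)) ⟩
      2 + A                           ∎
      where open ≡-Reasoning

    hook₁ⱼ+j-high : ∀ j → B < j → j ≤ A → hook ν 1 j + j ≡ suc A
    hook₁ⱼ+j-high j B<j j≤A =
      trans (cong (λ n → A ∸ j + (n ∸ 1) + 1 + j) (conj-ν-high j B<j j≤A))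
            (trans (cong (λ x → x + 1 + j) (+-identityʳ (A ∸ j))) (m∸n+1+n≡1+m j≤A))

    leg₁ⱼ₀ : leg ν 1 j₀ ≡ 1
    leg₁ⱼ₀ = cong (_∸ 1) (conj-ν-low j₀ 2≤j₀ j₀≤B)

    rim₁ⱼ₀ : removeRim ν 1 j₀ ≡ (B ∸ 1) ∷ (j₀ ∸ 1) ∷ replicate c 1
    rim₁ⱼ₀ = trans (rim-by-rows 1 j₀)
      (trans (cong dropZeros (cong₂ _∷_ row₁ (cong₂ _∷_ row₂ (map-interval-const 3 c 1 kept))))
        (trans (dropZeros-pos _ (∸-monoˡ-≤ 1 2≤B))
          (cong ((B ∸ 1) ∷_) (trans (dropZeros-pos _ (∸-monoˡ-≤ 1 2≤j₀))
                                     (cong ((j₀ ∸ 1) ∷_) (dropZeros-replicate-1 c))))))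
      where
      foot : 1 + leg ν 1 j₀ ≡ 2
      foot = cong suc leg₁ⱼ₀
      row₁ : rimRow ν 1 j₀ 1 ≡ B ∸ 1
      row₁ = rimRow-along ν 1 j₀ 1 ≤-refl (subst (1 <_) (sym foot) ≤-refl)
      row₂ : rimRow ν 1 j₀ 2 ≡ j₀ ∸ 1
      row₂ = rimRow-foot ν 1 j₀ 2 (s≤s z≤n) (sym foot)
      kept : ∀ t → 3 ≤ t → t < 3 + c → rimRow ν 1 j₀ t ≡ 1
      kept t 3≤t t<end = trans (rimRow-below ν 1 j₀ t (subst (_< t) (sym foot) 3≤t)) (at-ν t 3≤t (≤-pred t<end))

    leg₂₁ : leg ν 2 1 ≡ c
    leg₂₁ = cong (_∸ 2) conj-ν-1

    rim₂₁ : removeRim ν 2 1 ≡ A ∷ []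
    rim₂₁ = trans (rim-by-rows 2 1)
      (trans (cong dropZeros (cong₂ _∷_ (rimRow-above ν 2 1 1 ≤-refl) (map-interval-const 2 (suc c) 0 emptied)))
        (trans (dropZeros-pos _ 1≤A) (cong (A ∷_) (dropZeros-replicate-0 (suc c)))))
      where
      foot : 2 + leg ν 2 1 ≡ 2 + c
      foot = cong (_+_ 2) leg₂₁
      emptied : ∀ t → 2 ≤ t → t < 2 + suc c → rimRow ν 2 1 t ≡ 0
      emptied t 2≤t t<end with t <? 2 + c
      ... | yes t<2+c = trans (rimRow-along ν 2 1 t 2≤t (subst (t <_) (sym foot) t<2+c))
                              (cong (_∸ 1) (at-ν (suc t) (s≤s 2≤t) t<2+c))
      ... | no t≮2+c  = rimRow-foot ν 2 1 t 2≤t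
                          (trans (≤-antisym (≤-pred (subst (t <_) (+-suc 2 c) t<end)) (≮⇒≥ t≮2+c)) (sym foot))

    hook₂ⱼ+j : ∀ j → 2 ≤ j → j ≤ B → hook ν 2 j + j ≡ suc B
    hook₂ⱼ+j j 2≤j j≤B =
      trans (cong (λ n → B ∸ j + (n ∸ 2) + 1 + j) (conj-ν-low j 2≤j j≤B))
            (trans (cong (λ x → x + 1 + j) (+-identityʳ (B ∸ j))) (m∸n+1+n≡1+m j≤B))

    hookᵢ₁+i : ∀ i → 3 ≤ i → i ≤ 2 + c → hook ν i 1 + i ≡ 3 + c
    hookᵢ₁+i i 3≤i i≤2+c =
      trans (cong₂ (λ a n → a ∸ 1 + (n ∸ i) + 1 + i) (at-ν i 3≤i i≤2+c) conj-ν-1) (m∸n+1+n≡1+m i≤2+c)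

    high-misses : ∀ t → B < t → t ≤ A → hook ν 1 t ≢ r
    high-misses t B<t t≤A hook≡r = <-irrefl refl (begin-strict
      suc A           <⟨ n<1+n (suc A) ⟩
      2 + A           ≡⟨ r+j₀≡2+A ⟨
      r + j₀          <⟨ +-monoʳ-< r (≤-<-trans j₀≤B B<t) ⟩
      r + t           ≡⟨ cong (_+ t) hook≡r ⟨
      hook ν 1 t + t  ≡⟨ hook₁ⱼ+j-high t B<t t≤A ⟩
      suc A           ∎)
      where open ≤-Reasoning

    row₁ : rowSum term ν 1 ≡ - χ ((B ∸ 1) ∷ (j₀ ∸ 1) ∷ replicate c 1) μ
    row₁ = begin
      sumℤ (λ j → term (1 , j)) (interval 1 A)
        ≡⟨ sumℤ-single 1 A j₀ (≤-trans (s≤s z≤n) 2≤j₀) (s≤s (≤-trans j₀≤B B≤A)) others ⟩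
      term (1 , j₀)
        ≡⟨ mnTerm-hit ν r μ 1 j₀ hook≡r leg₁ⱼ₀ rim₁ⱼ₀ ⟩
      negOnePow 1 * χ ((B ∸ 1) ∷ (j₀ ∸ 1) ∷ replicate c 1) μ
        ≡⟨ ℤ.-1*i≡-i _ ⟩
      - χ ((B ∸ 1) ∷ (j₀ ∸ 1) ∷ replicate c 1) μ ∎
      where
      open ≡-Reasoning
      hook≡r : hook ν 1 j₀ ≡ r
      hook≡r = +-cancelʳ-≡ j₀ (hook ν 1 j₀) r (trans (hook₁ⱼ+j-low j₀ 2≤j₀ j₀≤B) (sym r+j₀≡2+A))
      others : ∀ t → 1 ≤ t → t < 1 + A → t ≢ j₀ → term (1 , t) ≡ + 0
      others t 1≤t t<end t≢j₀ with t ≤? 1 | t ≤? B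
      ... | yes t≤1 | _     =
            subst (λ t → term (1 , t) ≡ + 0) (≤-antisym 1≤t t≤1) (mnTerm-miss ν r μ 1 1 hook₁₁≢r)
      ... | no t≰1 | yes t≤B = mnTerm-miss ν r μ 1 t (λ hook≡r → t≢j₀ (+-cancelˡ-≡ r t j₀
            (trans (cong (_+ t) (sym hook≡r)) (trans (hook₁ⱼ+j-low t (≰⇒> t≰1) t≤B) (sym r+j₀≡2+A)))))
      ... | no _   | no t≰B  = mnTerm-miss ν r μ 1 t (high-misses t (≰⇒> t≰B) (≤-pred t<end))

    row₂ : rowSum term ν 2 ≡ (if B + c ≡ᵇ r then negOnePow c * χ (A ∷ []) μ else + 0)
    row₂ = begin
      sumℤ (λ j → term (2 , j)) (interval 1 B)
        ≡⟨ cong (sumℤ (λ j → term (2 , j))) (interval-cons 1 B 1≤B) ⟩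
      term (2 , 1) +ℤ sumℤ (λ j → term (2 , j)) (interval 2 (B ∸ 1))
        ≡⟨ cong₂ _+ℤ_ (mnTerm-at ν r μ 2 1 (hook₂₁-twoRowHook c 1≤B B≤A) leg₂₁ rim₂₁)
                      (sumℤ-vanishes 2 (B ∸ 1) missed) ⟩
      (if B + c ≡ᵇ r then negOnePow c * χ (A ∷ []) μ else + 0) +ℤ + 0
        ≡⟨ ℤ.+-identityʳ _ ⟩
      (if B + c ≡ᵇ r then negOnePow c * χ (A ∷ []) μ else + 0) ∎
      where
      open ≡-Reasoning
      missed : ∀ t → 2 ≤ t → t < 2 + (B ∸ 1) → term (2 , t) ≡ + 0
      missed t 2≤t t<end = mnTerm-miss ν r μ 2 t (λ hook≡r → <⇒≱ (+-≥2⇒< 2≤t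
        (trans (cong (_+ t) (sym hook≡r))
               (hook₂ⱼ+j t 2≤t (≤-pred (subst (t <_) (2+[m∸1]≡1+m 1≤B) t<end))))) B≤r)

    lower-rows : sumℤ (rowSum term ν) (interval 3 c) ≡ + 0
    lower-rows = sumℤ-vanishes 3 c (λ t 3≤t t<end →
      trans (cong (sumℤ (λ j → term (t , j)) ∘ interval 1) (at-ν t 3≤t (≤-pred t<end)))
            (trans (ℤ.+-identityʳ _) (mnTerm-miss ν r μ t 1 (misses t 3≤t (≤-pred t<end)))))
      where
      misses : ∀ t → 3 ≤ t → t ≤ 2 + c → hook ν t 1 ≢ r
      misses (suc t) (s≤s 2≤t) t<2+c hook≡r = <⇒≱ c<r (≤-pred (+-≥2⇒< 2≤t (suc-injective (begin
        suc (r + t)              ≡⟨ +-suc r t ⟨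
        r + suc t                ≡⟨ cong (_+ suc t) hook≡r ⟨
        hook ν (suc t) 1 + suc t ≡⟨ hookᵢ₁+i (suc t) (s≤s 2≤t) t<2+c ⟩
        3 + c                    ∎))))
        where open ≡-Reasoning

  χ-twoRowHookShape : χ (A ∷ B ∷ replicate c 1) (r ∷ μ)
    ≡ - χ ((B ∸ 1) ∷ (j₀ ∸ 1) ∷ replicate c 1) μ
      +ℤ (if B + c ≡ᵇ r then negOnePow c * χ (A ∷ []) μ else + 0)
  χ-twoRowHookShape = begin
    χ ν (r ∷ μ)
      ≡⟨ χ-by-rows A (B ∷ replicate c 1) r μ ⟩
    sumℤ (rowSum term ν) (interval 1 (2 + length (replicate c 1)))
      ≡⟨ cong (sumℤ (rowSum term ν) ∘ interval 1 ∘ (_+_ 2)) (List.length-replicate c) ⟩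
    rowSum term ν 1 +ℤ (rowSum term ν 2 +ℤ sumℤ (rowSum term ν) (interval 3 c))
      ≡⟨ cong₂ _+ℤ_ row₁ (cong₂ _+ℤ_ row₂ lower-rows) ⟩
    - χ ((B ∸ 1) ∷ (j₀ ∸ 1) ∷ replicate c 1) μ
      +ℤ ((if B + c ≡ᵇ r then negOnePow c * χ (A ∷ []) μ else + 0) +ℤ + 0)
      ≡⟨ cong (- χ ((B ∸ 1) ∷ (j₀ ∸ 1) ∷ replicate c 1) μ +ℤ_) (ℤ.+-identityʳ _) ⟩
    - χ ((B ∸ 1) ∷ (j₀ ∸ 1) ∷ replicate c 1) μ
      +ℤ (if B + c ≡ᵇ r then negOnePow c * χ (A ∷ []) μ else + 0) ∎
    where open ≡-Reasoning


-- Only the last part of a base can repeat an earlier one, as in (1,1) and (3,2,1,1).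
signBase-strict : ∀ {γ} → SignBase γ → ∀ i j → 1 ≤ i → i < j → j < length γ → at γ j < at γ i
signBase-strict _ zero           _                () _               _
signBase-strict _ (suc i)        (suc zero)       _  (s≤s ())        _
signBase-strict _ (suc (suc i))  (suc (suc zero)) _  (s≤s (s≤s ()))  _
signBase-strict _ (suc (suc (suc i))) (suc (suc (suc zero))) _ (s≤s (s≤s (s≤s ()))) _
signBase-strict base-11 1 2 _ _ (s≤s (s≤s ()))
signBase-strict base-3211 1 2 _ _ _ = ≤-refl
signBase-strict base-3211 1 3 _ _ _ = s≤s (s≤s z≤n)
signBase-strict base-3211 2 3 _ _ _ = s≤s (s≤s z≤n)
signBase-strict base-5321 1 2 _ _ _ = s≤s (s≤s (s≤s (s≤s z≤n)))
signBase-strict base-5321 1 3 _ _ _ = s≤s (s≤s (s≤s z≤n))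
signBase-strict base-5321 2 3 _ _ _ = s≤s (s≤s (s≤s z≤n))
signBase-strict (base-aa1 _ (s≤s (s≤s _))) 1 2 _ _ _ = ≤-refl
signBase-strict (base-aa21 _ (s≤s (s≤s (s≤s (s≤s _))))) 1 2 _ _ _ = ≤-refl
signBase-strict (base-aa21 _ (s≤s (s≤s (s≤s (s≤s _))))) 1 3 _ _ _ = s≤s (s≤s (s≤s z≤n))
signBase-strict (base-aa21 _ (s≤s (s≤s (s≤s (s≤s _))))) 2 3 _ _ _ = s≤s (s≤s (s≤s z≤n))
signBase-strict (base-aa31 _ (s≤s (s≤s (s≤s (s≤s (s≤s _)))))) 1 2 _ _ _ = ≤-refl
signBase-strict (base-aa31 _ (s≤s (s≤s (s≤s (s≤s (s≤s _)))))) 1 3 _ _ _ = s≤s (s≤s (s≤s (s≤s z≤n)))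
signBase-strict (base-aa31 _ (s≤s (s≤s (s≤s (s≤s (s≤s _)))))) 2 3 _ _ _ = s≤s (s≤s (s≤s (s≤s z≤n)))
signBase-strict base-11        _ (suc (suc (suc _)))       _ _ (s≤s (s≤s ()))
signBase-strict (base-aa1 _ _) _ (suc (suc (suc _)))       _ _ (s≤s (s≤s (s≤s ())))
signBase-strict base-3211        _ (suc (suc (suc (suc _)))) _ _ (s≤s (s≤s (s≤s (s≤s ()))))
signBase-strict base-5321        _ (suc (suc (suc (suc _)))) _ _ (s≤s (s≤s (s≤s (s≤s ()))))
signBase-strict (base-aa21 _ _) _ (suc (suc (suc (suc _)))) _ _ (s≤s (s≤s (s≤s (s≤s ()))))
signBase-strict (base-aa31 _ _) _ (suc (suc (suc (suc _)))) _ _ (s≤s (s≤s (s≤s (s≤s ()))))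

inSign-strict : ∀ {γ} → InSign γ → ∀ i j → 1 ≤ i → i < j → j < length γ → at γ j < at γ i
inSign-strict {γ} (_ , s , _ , dominant , base) = prefix-strict γ s dominant base
  where
  prefix-strict : ∀ γ s → (∀ i → 1 ≤ i → i ≤ s → at γ i > tailSum γ (suc i)) → SignBase (drop s γ) →
                  ∀ i j → 1 ≤ i → i < j → j < length γ → at γ j < at γ i
  prefix-strict γ zero _ base = signBase-strict base
  prefix-strict (x ∷ γ) (suc s) _ _ (suc zero) (suc zero) _ (s≤s ()) _
  prefix-strict (x ∷ γ) (suc s) dominant _ (suc zero) (suc (suc j)) _ _ _ =
    ≤-<-trans (≤-trans (at≤tailSum γ (suc j) (s≤s z≤n)) (tailSum≤size γ (suc j)))
              (dominant 1 ≤-refl (s≤s z≤n))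
  prefix-strict (x ∷ γ) (suc s) dominant base (suc (suc i)) (suc (suc j)) _ (s≤s i<j) (s≤s j<len) =
    prefix-strict γ s dominant′ base (suc i) (suc j) (s≤s z≤n) i<j j<len
    where
    dominant′ : ∀ i → 1 ≤ i → i ≤ s → at γ i > tailSum γ (suc i)
    dominant′ (suc i) _ i<s = dominant (suc (suc i)) (s≤s z≤n) (s≤s i<s)

inSign-cons : ∀ {x γ} → IsPartition (x ∷ γ) → InSign γ → size γ < x → InSign (x ∷ γ)
inSign-cons {x} {γ} x∷γ-partition (_ , s , s≤len , dominant , base) γ<x =
  x∷γ-partition , suc s , s≤s s≤len , dominant′ , base
  where
  dominant′ : ∀ i → 1 ≤ i → i ≤ suc s → at (x ∷ γ) i > tailSum (x ∷ γ) (suc i)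
  dominant′ (suc zero)    _ _         = γ<x
  dominant′ (suc (suc i)) _ (s≤s i<s) = dominant (suc i) (s≤s z≤n) i<s

difference≤size : ∀ {a₁ a₂ μ} → IsPartition (a₁ ∷ a₂ ∷ μ) →
                  ¬ InSign (a₁ ∷ a₂ ∷ μ) → InSign (a₂ ∷ μ) → a₁ ∸ a₂ ≤ size μ
difference≤size {a₁} {a₂} {μ} α-partition α∉Sign α′∈Sign =
  subst (a₁ ∸ a₂ ≤_) (m+n∸m≡n a₂ (size μ))
        (∸-monoˡ-≤ a₂ (≮⇒≥ (α∉Sign ∘ inSign-cons α-partition α′∈Sign)))


module _ (a₂ d e : ℕ) (μ : List ℕ) (μ⁺ : Positive μ)
         (size-μ : size μ ≡ suc d + suc e) (μ<a₂ : size μ < a₂)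
         (χ-part : χ (suc e ∷ replicate (suc d) 1) μ ≡ negOnePow d) where

  private
    size≤a₂ : size μ ≤ a₂
    size≤a₂ = <⇒≤ μ<a₂

    2+e≤a₂ : 2 + e ≤ a₂
    2+e≤a₂ = ≤-trans (s≤s (m≤n+m (suc e) d)) (subst (_≤ a₂) size-μ size≤a₂)

    d<a₂ : d < a₂
    d<a₂ = ≤-trans (s≤s (m≤m+n d (suc e))) (subst (_≤ a₂) size-μ size≤a₂)

    2+e+d≡size : 2 + e + d ≡ size μ
    2+e+d≡size = sym (trans size-μ (cong suc (trans (+-suc d e) (cong suc (+-comm d e)))))

    1≤size : 1 ≤ size μ
    1≤size = subst (1 ≤_) (sym size-μ) (s≤s z≤n)

  χ-β-remainder : χ (a₂ ∷ (2 + e) ∷ replicate d 1) (a₂ ∷ μ) ≡ - negOnePow d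
  χ-β-remainder = begin
    χ (a₂ ∷ (2 + e) ∷ replicate d 1) (a₂ ∷ μ)
      ≡⟨ TwoRowHookShape.χ-twoRowHookShape a₂ (2 + e) d a₂ 2 μ
           ≤-refl (s≤s (s≤s z≤n)) 2+e≤a₂ (+-comm a₂ 2) 2+e≤a₂ d<a₂ ⟩
    - χ (suc e ∷ replicate (suc d) 1) μ +ℤ (if 2 + e + d ≡ᵇ a₂ then negOnePow d * χ (a₂ ∷ []) μ else + 0)
      ≡⟨ cong₂ _+ℤ_ (cong -_ χ-part)
                    (if-false (dec-false (2 + e + d ≟ a₂) (λ eq → <⇒≢ μ<a₂ (trans (sym 2+e+d≡size) eq)))) ⟩
    - negOnePow d +ℤ + 0
      ≡⟨ ℤ.+-identityʳ _ ⟩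
    - negOnePow d ∎
    where open ≡-Reasoning

  χ-β′ : χ ((a₂ + size μ) ∷ suc a₂ ∷ replicate d 1) ((a₂ + suc d) ∷ a₂ ∷ μ) ≡ + 2 * negOnePow d
  χ-β′ = begin
    χ ((a₂ + size μ) ∷ suc a₂ ∷ replicate d 1) ((a₂ + suc d) ∷ a₂ ∷ μ)
      ≡⟨ TwoRowHookShape.χ-twoRowHookShape (a₂ + size μ) (suc a₂) d (a₂ + suc d) (3 + e) (a₂ ∷ μ)
           (s≤s (s≤s z≤n)) (s≤s 2+e≤a₂) 1+a₂≤a₂+size r+j₀≡2+A 1+a₂≤a₂+1+d
           (<-≤-trans (n<1+n d) (m≤n+m (suc d) a₂)) ⟩
    - χ (a₂ ∷ (2 + e) ∷ replicate d 1) (a₂ ∷ μ)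
      +ℤ (if suc a₂ + d ≡ᵇ a₂ + suc d then negOnePow d * χ ((a₂ + size μ) ∷ []) (a₂ ∷ μ) else + 0)
      ≡⟨ cong₂ _+ℤ_ (cong -_ χ-β-remainder)
                    (if-true (dec-true (suc a₂ + d ≟ a₂ + suc d) (sym (+-suc a₂ d)))) ⟩
    - - negOnePow d +ℤ negOnePow d * χ ((a₂ + size μ) ∷ []) (a₂ ∷ μ)
      ≡⟨ cong₂ _+ℤ_ (ℤ.neg-involutive (negOnePow d)) (cong (negOnePow d *_) χ-trivial-α′) ⟩
    negOnePow d +ℤ negOnePow d * + 1
      ≡⟨ cong (negOnePow d +ℤ_) (ℤ.*-identityʳ _) ⟩
    negOnePow d +ℤ negOnePow d
      ≡⟨ i+i≡2*i (negOnePow d) ⟩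
    + 2 * negOnePow d ∎
    where
    open ≡-Reasoning
    1+a₂≤a₂+size : suc a₂ ≤ a₂ + size μ
    1+a₂≤a₂+size = subst (_≤ a₂ + size μ) (+-comm a₂ 1) (+-monoʳ-≤ a₂ 1≤size)
    1+a₂≤a₂+1+d : suc a₂ ≤ a₂ + suc d
    1+a₂≤a₂+1+d = subst (suc a₂ ≤_) (sym (+-suc a₂ d)) (s≤s (m≤m+n a₂ d))
    r+j₀≡2+A : a₂ + suc d + (3 + e) ≡ 2 + (a₂ + size μ)
    r+j₀≡2+A = trans (solve 3 (λ a d e → (a :+ (con 1 :+ d)) :+ (con 3 :+ e)
                                     := con 2 :+ (a :+ ((con 1 :+ d) :+ (con 1 :+ e)))) refl a₂ d e)
                     (cong (λ n → 2 + (a₂ + n)) (sym size-μ))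
    χ-trivial-α′ : χ ((a₂ + size μ) ∷ []) (a₂ ∷ μ) ≡ + 1
    χ-trivial-α′ = χ-trivial (a₂ ∷ μ) (a₂ + size μ) (≤-trans 1≤size (m≤n+m (size μ) a₂))
                             (≤-trans (s≤s z≤n) μ<a₂ ∷ μ⁺) refl

χ-β : ∀ a₂ D μ → Positive μ → 1 ≤ D → D < size μ → size μ < a₂ →
      χ ((size μ ∸ D) ∷ replicate D 1) μ ≡ negOnePow (D ∸ 1) →
      χ ((a₂ + size μ) ∷ suc a₂ ∷ replicate (D ∸ 1) 1) ((a₂ + D) ∷ a₂ ∷ μ) ≡ + 2 * negOnePow (D ∸ 1)
χ-β a₂ (suc d) μ μ⁺ _ D<size μ<a₂ χ-part with m≤n⇒∃[o]m+o≡n D<size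
... | e , 2+d+e≡size =
  χ-β′ a₂ d e μ μ⁺ size-μ μ<a₂ (trans (cong (λ m → χ (m ∷ replicate (suc d) 1) μ) size∸D) χ-part)
  where
  size-μ : size μ ≡ suc d + suc e
  size-μ = sym (trans (+-suc (suc d) e) 2+d+e≡size)
  size∸D : suc e ≡ size μ ∸ suc d
  size∸D = sym (trans (cong (_∸ suc d) size-μ) (m+n∸m≡n (suc d) (suc e)))

module _ (a₁ a₂ R : ℕ) (1≤R : 1 ≤ R) where

  private
    1+a₂≤β₁ : suc a₂ ≤ a₁ + (a₂ + R) ∸ a₁
    1+a₂≤β₁ = subst (suc a₂ ≤_) (sym (m+n∸m≡n a₁ (a₂ + R)))
                    (subst (_≤ a₂ + R) (+-comm a₂ 1) (+-monoʳ-≤ a₂ 1≤R))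

  β-isPartition : IsPartition ((a₁ + (a₂ + R) ∸ a₁) ∷ suc a₂ ∷ replicate (a₁ ∸ a₂ ∸ 1) 1)
  β-isPartition = twoRowHook-isPartition (a₁ ∸ a₂ ∸ 1) (s≤s z≤n) 1+a₂≤β₁

  β-hook₂₁ : a₂ < a₁ → hook ((a₁ + (a₂ + R) ∸ a₁) ∷ suc a₂ ∷ replicate (a₁ ∸ a₂ ∸ 1) 1) 2 1 ≡ a₁
  β-hook₂₁ a₂<a₁ = begin
    hook ((a₁ + (a₂ + R) ∸ a₁) ∷ suc a₂ ∷ replicate (a₁ ∸ a₂ ∸ 1) 1) 2 1
      ≡⟨ hook₂₁-twoRowHook (a₁ ∸ a₂ ∸ 1) (s≤s z≤n) 1+a₂≤β₁ ⟩
    suc a₂ + (a₁ ∸ a₂ ∸ 1) ≡⟨ 1+m+[n∸1]≡m+n a₂ (m<n⇒0<n∸m a₂<a₁) ⟩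
    a₂ + (a₁ ∸ a₂)         ≡⟨ m+[n∸m]≡n (<⇒≤ a₂<a₁) ⟩
    a₁                     ∎
    where open ≡-Reasoning

part-in-tail : ∀ a₁ a₂ μ i → a₂ < a₁ → a₁ ∸ a₂ ≤ size μ → size μ < a₂ → 1 ≤ i →
               at (a₁ ∷ a₂ ∷ μ) i ≡ a₁ ∸ a₂ → ∃[ j ] i ≡ 3 + j
part-in-tail a₁ a₂ μ 1 a₂<a₁ _ μ<a₂ _ a₁≡D =
  ⊥-elim (<⇒≢ (∸-monoʳ-< (≤-<-trans z≤n μ<a₂) (<⇒≤ a₂<a₁)) (sym a₁≡D))
part-in-tail a₁ a₂ μ 2 _ D≤size μ<a₂ _ a₂≡D =
  ⊥-elim (<⇒≱ μ<a₂ (subst (_≤ size μ) (sym a₂≡D) D≤size))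
part-in-tail a₁ a₂ μ (suc (suc (suc j))) _ _ _ _ _ = j , refl

theorem8 : (α : List ℕ) → IsPartition α →
    (k : ℕ) → 1 ≤ k → k ≤ suc (length α) →
    tailSum α k < at α 1 ∸ at α 2 →
    (∀ j → 1 ≤ j → j < k → ¬ (tailSum α j < at α 1 ∸ at α 2)) →
    ¬ InSign α → InSign (drop 1 α) →
    at α 1 > at α 2 → at α 2 > tailSum α 3 →
    k ≤ length α →
    (∃[ i ] (1 ≤ i × i ≤ length α × at α i ≡ at α 1 ∸ at α 2 × at α i ≥ tailSum α (suc i))) →
    IsPartition ((size α ∸ at α 1) ∷ suc (at α 2) ∷ replicate (at α 1 ∸ at α 2 ∸ 1) 1)
    × hook ((size α ∸ at α 1) ∷ suc (at α 2) ∷ replicate (at α 1 ∸ at α 2 ∸ 1) 1) 2 1 ≡ at α 1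
    × χ ((size α ∸ at α 1) ∷ suc (at α 2) ∷ replicate (at α 1 ∸ at α 2 ∸ 1) 1) α
      ≡ + 2 * negOnePow (at α 1 ∸ at α 2 ∸ 1)
theorem8 []           _ _ _ _ _ _ _ _ () _ _ _
theorem8 (a₁ ∷ [])    _ _ _ _ _ _ _ _ _ () _ _
theorem8 (a₁ ∷ a₂ ∷ μ) α-partition@((_ ∷ _ ∷ μ⁺) , _) k 1≤k _ tailₖ<D _ α∉Sign α′∈Sign a₂<a₁ μ<a₂
         k≤h (i , 1≤i , _ , αᵢ≡D , D≥tail)
  with j , refl ← part-in-tail a₁ a₂ μ i a₂<a₁ (difference≤size α-partition α∉Sign α′∈Sign) μ<a₂
                               1≤i αᵢ≡D =
  β-isPartition a₁ a₂ (size μ) 1≤size , β-hook₂₁ a₁ a₂ (size μ) 1≤size a₂<a₁ ,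
  subst₂ (λ m a → χ (m ∷ suc a₂ ∷ replicate (D ∸ 1) 1) (a ∷ a₂ ∷ μ) ≡ + 2 * negOnePow (D ∸ 1))
         (sym (m+n∸m≡n a₁ (a₂ + size μ))) (m+[n∸m]≡n (<⇒≤ a₂<a₁))
         (χ-β a₂ D μ μ⁺ 1≤D D<size μ<a₂ χ-part)
  where
  D : ℕ
  D = a₁ ∸ a₂
  1≤D : 1 ≤ D
  1≤D = m<n⇒0<n∸m a₂<a₁
  j<len : suc j < length μ
  j<len = ≤-pred (≤-pred (≤-trans i<k k≤h))
    where
    i<k : 3 + j < k
    i<k = tailSum<at⇒< (a₁ ∷ a₂ ∷ μ) 1≤i 1≤k (subst (_ <_) (sym αᵢ≡D) tailₖ<D)
  D<size : D < size μ
  D<size = subst (_< size μ) αᵢ≡D (at<size μ (suc j) μ⁺ (s≤s z≤n) j<len)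
  1≤size : 1 ≤ size μ
  1≤size = ≤-trans 1≤D (<⇒≤ D<size)
  earlier : ∀ i → 1 ≤ i → i < suc j → at μ (suc j) < at μ i
  earlier (suc i) _ i<j = inSign-strict α′∈Sign (suc (suc i)) (suc (suc j)) (s≤s z≤n) (s≤s i<j) (s≤s j<len)
  χ-part : χ ((size μ ∸ D) ∷ replicate D 1) μ ≡ negOnePow (D ∸ 1)
  χ-part = subst (λ d → χ ((size μ ∸ d) ∷ replicate d 1) μ ≡ negOnePow (d ∸ 1)) αᵢ≡D
             (χ-hookShape-part μ (suc j) μ⁺ (s≤s z≤n) j<len D≥tail earlier)
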